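{- Let $M$ be a matroid with ground set $\mathcal{A}$ and rank function $\mathrm{rk}$, and let $a\in\mathcal{A}$ be neither a loop nor a coloop. Then $$S_M(x,y,z)=S_{M\backslash a}(x,y,z)+S_{M/a}(x,y,z)+z\sum_{A\subseteq B\subseteq\mathcal{A}-a}x^{|A|-\mathrm{rk}(A)}y^{\mathrm{rk}(M/a)-\mathrm{rk}_{M/a}(B)}z^{|B|-|A|}.$$
   Context: Ford's $S$-polynomial of a matroid $N$ on ground set $E$ with rank function $\mathrm{rk}_N$ is $S_N(x,y,z)=\sum_{A\subseteq B\subseteq E}x^{|A|-\mathrm{rk}_N(A)}y^{\mathrm{rk}_N(E)-\mathrm{rk}_N(B)}z^{|B|-|A|}$. $M\backslash a$ is the deletion (ground set $\mathcal{A}-a$, rank function restricted), $M/a$ the contraction (ground set $\mathcal{A}-a$, $\mathrm{rk}_{M/a}(X)=\mathrm{rk}(X\cup a)-\mathrm{rk}(a)$), and $\mathrm{rk}(M/a)=\mathrm{rk}_{M/a}(\mathcal{A}-a)$. A loop is an element of rank $0$; a coloop is an element $a$ with $\mathrm{rk}(\mathcal{A}-a)=\mathrm{rk}(\mathcal{A})-1$. -}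

module Defs where

open import Level using (Level)
open import Data.Nat using (ℕ; zero; suc; _∸_; _≤_)
open import Data.Nat as ℕ using ()
open import Data.Bool using (true; false)
open import Data.Product using (_×_; _,_)
open import Data.List using (List; []; _∷_; map; concatMap; filter; foldr; _++_)
open import Data.Vec using (_∷_; [])
open import Data.Fin using (Fin)
open import Data.Fin.Subset using (Subset; _⊆_; _∪_; _∩_; ⁅_⁆; ⊤; ⊥; _-_; ∣_∣)
open import Data.Fin.Subset.Properties using (_⊆?_)
open import Relation.Nullary using (¬_)
open import Relation.Binary.PropositionalEquality using (_≡_)
open import Algebra.Bundles using (CommutativeRing; Semiring)
import Algebra.Definitions.RawSemiring as RS

record Matroid (n : ℕ) : Set where
  field
    rk           : Subset n → ℕ
    rk-bounded   : ∀ X → rk X ≤ ∣ X ∣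
    rk-monotone  : ∀ X Y → X ⊆ Y → rk X ≤ rk Y
    rk-submod    : ∀ X Y → rk (X ∪ Y) ℕ.+ rk (X ∩ Y) ≤ rk X ℕ.+ rk Y

-- A "set system with rank": a ground set E ⊆ Fin n together with a rank
-- function on subsets of Fin n (only its values on subsets of E matter).
-- Deletions and contractions of a matroid on Fin n are represented this
-- way, with ground set 𝒜 - a.
record RankedSet (n : ℕ) : Set where
  constructor ranked
  field
    ground : Subset n
    rank   : Subset n → ℕ

allSubsets : (n : ℕ) → List (Subset n)
allSubsets zero    = [] ∷ []
allSubsets (suc n) = map (true ∷_) (allSubsets n) ++ map (false ∷_) (allSubsets n)

chains : {n : ℕ} → Subset n → List (Subset n × Subset n)
chains {n} E =
  concatMap (λ B → map (λ A → A , B) (filter (_⊆? B) (allSubsets n)))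
            (filter (_⊆? E) (allSubsets n))

module _ {c ℓ : Level} (R : CommutativeRing c ℓ) where
  open CommutativeRing R using (Carrier; _+_; _*_; 0#; semiring)
  open RS (Semiring.rawSemiring semiring) using (_^_)

  pow : Carrier → ℕ → Carrier
  pow x k = x ^ k

  sumChains : {n : ℕ} → Subset n → (Subset n → Subset n → Carrier) → Carrier
  sumChains E f = foldr (λ { (A , B) acc → f A B + acc }) 0# (chains E)

  S : {n : ℕ} → RankedSet n → Carrier → Carrier → Carrier → Carrier
  S (ranked E r) x y z =
    sumChains E (λ A B → x ^ (∣ A ∣ ∸ r A) * y ^ (r E ∸ r B) * z ^ (∣ B ∣ ∸ ∣ A ∣))

module _ {n : ℕ} (M : Matroid n) where
  open Matroid M

  asRanked : RankedSet n
  asRanked = ranked ⊤ rk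

  deletion : Fin n → RankedSet n
  deletion a = ranked (⊤ - a) rk

  rkContr : Fin n → Subset n → ℕ
  rkContr a X = rk (X ∪ ⁅ a ⁆) ∸ rk ⁅ a ⁆

  contraction : Fin n → RankedSet n
  contraction a = ranked (⊤ - a) (rkContr a)

  rkOfContr : Fin n → ℕ
  rkOfContr a = rkContr a (⊤ - a)

  IsLoop : Fin n → Set
  IsLoop a = rk ⁅ a ⁆ ≡ 0

  IsColoop : Fin n → Set
  IsColoop a = rk (⊤ - a) ℕ.+ 1 ≡ rk ⊤

{-# OPTIONS --safe #-}
-- Sort the chains A ⊆ B ⊆ 𝒜 by the position of a. Chains with a ∉ B are the
-- chains of M \ a, and as a is not a coloop, rk 𝒜 = rk (𝒜 - a), so their
-- monomials are those of S_{M\a}. Chains with a ∈ A are (A ∪ a, B ∪ a) for a chain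
-- A ⊆ B ⊆ 𝒜 - a; as a is not a loop, rk (X ∪ a) = 1 + rk_{M/a} X, which turns all
-- three exponents into those of S_{M/a}. Chains with a ∈ B - A are (A, B ∪ a):
-- the z-exponent grows by one and the y-exponent becomes the corank in M/a, while
-- the x-exponent is still the nullity of A in M, giving the last sum.
module Submission where

open import Level using (Level)
open import Data.Nat as ℕ using (ℕ; zero; suc; _∸_; _≤_)
import Data.Nat.Properties as ℕₚ
open import Data.Bool using (Bool; true; false; if_then_else_; not)
open import Data.Product using (_×_; _,_; proj₁; proj₂)
open import Data.Sum using (inj₁; inj₂)
open import Data.List using (List; []; _∷_; map; concatMap; filter; foldr; _++_)
open import Data.Vec using (_∷_; here; there)
open import Data.Fin using (Fin; zero; suc)
open import Data.Fin.Subset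
  using (Subset; _∉_; _⊆_; _∪_; _∩_; ⁅_⁆; ⊤; ⊥; ∣_∣; inside; outside) renaming (_-_ to _∖_)
open import Data.Fin.Subset.Properties
  using (_⊆?_; _∈?_; ⊆-trans; ⊆⊤; ∈⊤; p⊆p∪q; q⊆p∪q; x∈p∪q⁻; x∈p∪q⁺; x∈⁅y⁆⇒x≡y;
         x∈p∧x≢y⇒x∈p-y; ∪-identityʳ; p─⊥≡p; ∣⁅x⁆∣≡1; p⊆q⇒∣p∣≤∣q∣)
open import Function using (_∘_)
open import Function.Bundles using (_⇔_; mk⇔)
open import Relation.Nullary using (¬_; Dec; does; yes; no; contradiction)
open import Relation.Nullary.Decidable using (does-⇔; dec-true; dec-false)
open import Relation.Unary using (Pred; Decidable)
open import Relation.Binary.PropositionalEquality as ≡ using (_≡_; cong; cong₂)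
open import Algebra.Bundles using (Semiring; CommutativeRing)
import Algebra.Properties.CommutativeSemigroup as CommutativeSemigroupProperties
import Relation.Binary.Reasoning.Setoid as SetoidReasoning

open import Defs

module _ {n : ℕ} {a : Fin n} where

  ∪⁅⁆-monoˡ-⊆ : {p q : Subset n} → p ⊆ q → p ∪ ⁅ a ⁆ ⊆ q ∪ ⁅ a ⁆
  ∪⁅⁆-monoˡ-⊆ {p} p⊆q x∈ with x∈p∪q⁻ p ⁅ a ⁆ x∈
  ... | inj₁ x∈p = x∈p∪q⁺ (inj₁ (p⊆q x∈p))
  ... | inj₂ x∈a = x∈p∪q⁺ (inj₂ x∈a)

  ⊆-∪⁅⁆⁻ : {p q : Subset n} → a ∉ p → p ⊆ q ∪ ⁅ a ⁆ → p ⊆ q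
  ⊆-∪⁅⁆⁻ {q = q} a∉p p⊆q∪a x∈p with x∈p∪q⁻ q ⁅ a ⁆ (p⊆q∪a x∈p)
  ... | inj₁ x∈q = x∈q
  ... | inj₂ x∈a with x∈⁅y⁆⇒x≡y a x∈a
  ... | ≡.refl = contradiction x∈p a∉p

  ∪⁅⁆-cancelˡ-⊆ : {p q : Subset n} → a ∉ p → p ∪ ⁅ a ⁆ ⊆ q ∪ ⁅ a ⁆ → p ⊆ q
  ∪⁅⁆-cancelˡ-⊆ a∉p p∪a⊆q∪a = ⊆-∪⁅⁆⁻ a∉p (⊆-trans (p⊆p∪q ⁅ a ⁆) p∪a⊆q∪a)

  ∉⇒⊆⊤∖ : {p : Subset n} → a ∉ p → p ⊆ ⊤ ∖ a
  ∉⇒⊆⊤∖ a∉p x∈p = x∈p∧x≢y⇒x∈p-y ∈⊤ λ { ≡.refl → a∉p x∈p }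

x∉⊤∖x : ∀ {n} (a : Fin n) → a ∉ ⊤ ∖ a
x∉⊤∖x zero    ()
x∉⊤∖x (suc a) (there a∈⊤∖a) = x∉⊤∖x a a∈⊤∖a

⊆⊤∖⇒∉ : ∀ {n} {a : Fin n} {p : Subset n} → p ⊆ ⊤ ∖ a → a ∉ p
⊆⊤∖⇒∉ {a = a} p⊆ = x∉⊤∖x a ∘ p⊆

⊤∖x∪⁅x⁆≡⊤ : ∀ {n} (a : Fin n) → (⊤ ∖ a) ∪ ⁅ a ⁆ ≡ ⊤
⊤∖x∪⁅x⁆≡⊤ zero    = cong (inside ∷_) (≡.trans (∪-identityʳ _) (p─⊥≡p ⊤))
⊤∖x∪⁅x⁆≡⊤ (suc a) = cong (inside ∷_) (⊤∖x∪⁅x⁆≡⊤ a)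

∣p∪⁅x⁆∣≡1+∣p∣ : ∀ {n} {a : Fin n} (p : Subset n) → a ∉ p → ∣ p ∪ ⁅ a ⁆ ∣ ≡ suc ∣ p ∣
∣p∪⁅x⁆∣≡1+∣p∣ {a = zero}  (inside  ∷ p) a∉ = contradiction here a∉
∣p∪⁅x⁆∣≡1+∣p∣ {a = zero}  (outside ∷ p) a∉ = cong (suc ∘ ∣_∣) (∪-identityʳ p)
∣p∪⁅x⁆∣≡1+∣p∣ {a = suc a} (inside  ∷ p) a∉ = cong suc (∣p∪⁅x⁆∣≡1+∣p∣ p (a∉ ∘ there))
∣p∪⁅x⁆∣≡1+∣p∣ {a = suc a} (outside ∷ p) a∉ = ∣p∪⁅x⁆∣≡1+∣p∣ p (a∉ ∘ there)

module Sums {c ℓ : Level} (S : Semiring c ℓ) where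
  open Semiring S hiding (zero)
  open CommutativeSemigroupProperties +-commutativeSemigroup using (interchange)
  open SetoidReasoning setoid

  sumList : ∀ {a} {A : Set a} → (A → Carrier) → List A → Carrier
  sumList f = foldr (λ x acc → f x + acc) 0#

  when : Bool → Carrier → Carrier
  when b u = if b then u else 0#

  when-cong : ∀ {p} {P : Set p} (P? : Dec P) {u v : Carrier} → (P → u ≈ v) →
              when (does P?) u ≈ when (does P?) v
  when-cong (yes p) u≈v = u≈v p
  when-cong (no _)  _   = refl

  when-yes : ∀ {p} {P : Set p} (P? : Dec P) {u : Carrier} → P → when (does P?) u ≈ u
  when-yes P? {u} p = reflexive (cong (λ b → when b u) (dec-true P? p))

  when-no : ∀ {p} {P : Set p} (P? : Dec P) {u : Carrier} → ¬ P → when (does P?) u ≈ 0#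
  when-no P? {u} ¬p = reflexive (cong (λ b → when b u) (dec-false P? ¬p))

  when-⇔ : ∀ {p q} {P : Set p} {Q : Set q} → P ⇔ Q → (P? : Dec P) (Q? : Dec Q) {u : Carrier} →
           when (does P?) u ≈ when (does Q?) u
  when-⇔ P⇔Q P? Q? {u} = reflexive (cong (λ b → when b u) (does-⇔ P⇔Q P? Q?))

  when-0# : ∀ b → when b 0# ≈ 0#
  when-0# true  = refl
  when-0# false = refl

  when-+ : ∀ b u v → when b (u + v) ≈ when b u + when b v
  when-+ true  u v = refl
  when-+ false u v = sym (+-identityˡ 0#)

  module _ {a} {A : Set a} where

    sumList-cong : {f g : A → Carrier} (xs : List A) → (∀ x → f x ≈ g x) → sumList f xs ≈ sumList g xs
    sumList-cong []       f≈g = refl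
    sumList-cong (x ∷ xs) f≈g = +-cong (f≈g x) (sumList-cong xs f≈g)

    sumList-++ : (f : A → Carrier) (xs ys : List A) → sumList f (xs ++ ys) ≈ sumList f xs + sumList f ys
    sumList-++ f []       ys = sym (+-identityˡ _)
    sumList-++ f (x ∷ xs) ys = trans (+-congˡ (sumList-++ f xs ys)) (sym (+-assoc _ _ _))

    sumList-+ : (f g : A → Carrier) (xs : List A) →
                sumList (λ x → f x + g x) xs ≈ sumList f xs + sumList g xs
    sumList-+ f g []       = sym (+-identityˡ _)
    sumList-+ f g (x ∷ xs) = trans (+-congˡ (sumList-+ f g xs)) (interchange _ _ _ _)

    sumList-*ˡ : (k : Carrier) (f : A → Carrier) (xs : List A) → sumList (λ x → k * f x) xs ≈ k * sumList f xs
    sumList-*ˡ k f []       = sym (zeroʳ k)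
    sumList-*ˡ k f (x ∷ xs) = trans (+-congˡ (sumList-*ˡ k f xs)) (sym (distribˡ k _ _))

    sumList-0 : (xs : List A) → sumList (λ _ → 0#) xs ≈ 0#
    sumList-0 []       = refl
    sumList-0 (x ∷ xs) = trans (+-identityˡ _) (sumList-0 xs)

    sumList-filter : ∀ {p} {P : Pred A p} (P? : Decidable P) (f : A → Carrier) (xs : List A) →
                     sumList f (filter P? xs) ≈ sumList (λ x → when (does (P? x)) (f x)) xs
    sumList-filter P? f []       = refl
    sumList-filter P? f (x ∷ xs) with does (P? x)
    ... | true  = +-congˡ (sumList-filter P? f xs)
    ... | false = trans (sumList-filter P? f xs) (sym (+-identityˡ _))

  module _ {a b} {A : Set a} {B : Set b} where

    sumList-map : (f : B → Carrier) (g : A → B) (xs : List A) → sumList f (map g xs) ≈ sumList (f ∘ g) xs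
    sumList-map f g []       = refl
    sumList-map f g (x ∷ xs) = +-congˡ (sumList-map f g xs)

    sumList-concatMap : (f : B → Carrier) (g : A → List B) (xs : List A) →
                        sumList f (concatMap g xs) ≈ sumList (sumList f ∘ g) xs
    sumList-concatMap f g []       = refl
    sumList-concatMap f g (x ∷ xs) =
      trans (sumList-++ f (g x) (concatMap g xs)) (+-congˡ (sumList-concatMap f g xs))

  sumSubsets : (n : ℕ) → (Subset n → Carrier) → Carrier
  sumSubsets n g = sumList g (allSubsets n)

  sumSubsetsOf : ∀ {n} → Subset n → (Subset n → Carrier) → Carrier
  sumSubsetsOf {n} E g = sumSubsets n (λ X → when (does (X ⊆? E)) (g X))

  module _ {n : ℕ} where

    sumSubsets-cong : {f g : Subset n → Carrier} → (∀ X → f X ≈ g X) → sumSubsets n f ≈ sumSubsets n g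
    sumSubsets-cong = sumList-cong (allSubsets n)

    sumSubsets-+ : (f g : Subset n → Carrier) → sumSubsets n (λ X → f X + g X) ≈ sumSubsets n f + sumSubsets n g
    sumSubsets-+ f g = sumList-+ f g (allSubsets n)

    sumSubsets-suc : (g : Subset (suc n) → Carrier) →
                     sumSubsets (suc n) g ≈ sumSubsets n (g ∘ (inside ∷_)) + sumSubsets n (g ∘ (outside ∷_))
    sumSubsets-suc g =
      trans (sumList-++ g (map (inside ∷_) (allSubsets n)) (map (outside ∷_) (allSubsets n)))
            (+-cong (sumList-map g (inside ∷_) (allSubsets n)) (sumList-map g (outside ∷_) (allSubsets n)))

    sumSubsetsOf-cong : (E : Subset n) {f g : Subset n → Carrier} → (∀ {X} → X ⊆ E → f X ≈ g X) →
                        sumSubsetsOf E f ≈ sumSubsetsOf E g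
    sumSubsetsOf-cong E f≈g = sumSubsets-cong (λ X → when-cong (X ⊆? E) f≈g)

    sumSubsetsOf-+ : (E : Subset n) (f g : Subset n → Carrier) →
                     sumSubsetsOf E (λ X → f X + g X) ≈ sumSubsetsOf E f + sumSubsetsOf E g
    sumSubsetsOf-+ E f g =
      trans (sumSubsets-cong (λ X → when-+ (does (X ⊆? E)) (f X) (g X))) (sumSubsets-+ _ _)

    sumSubsetsOf-⊤ : (g : Subset n → Carrier) → sumSubsetsOf ⊤ g ≈ sumSubsets n g
    sumSubsetsOf-⊤ g = sumSubsets-cong (λ X → when-yes (X ⊆? ⊤) ⊆⊤)

    sumSubsetsOf-restrict : {B E : Subset n} → B ⊆ E → (g : Subset n → Carrier) →
                            sumSubsetsOf E (λ X → when (does (X ⊆? B)) (g X)) ≈ sumSubsetsOf B g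
    sumSubsetsOf-restrict {B} {E} B⊆E g = sumSubsets-cong restrict
      where
      restrict : ∀ X → when (does (X ⊆? E)) (when (does (X ⊆? B)) (g X)) ≈ when (does (X ⊆? B)) (g X)
      restrict X with X ⊆? B
      ... | yes X⊆B = when-yes (X ⊆? E) (⊆-trans X⊆B B⊆E)
      ... | no  _   = when-0# (does (X ⊆? E))

  sumSubsets-pairUp : ∀ {n} (a : Fin n) (g : Subset n → Carrier) →
                      sumSubsets n g ≈ sumSubsetsOf (⊤ ∖ a) (λ X → g X + g (X ∪ ⁅ a ⁆))
  sumSubsets-pairUp {n} a g = trans (pairUp a g) (sumSubsets-cong ∉-as-⊆)
    where
    pairUp : ∀ {m} (a : Fin m) (g : Subset m → Carrier) →
             sumSubsets m g ≈ sumSubsets m (λ X → when (not (does (a ∈? X))) (g X + g (X ∪ ⁅ a ⁆)))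
    pairUp {suc m} zero g = begin
        sumSubsets (suc m) g
      ≈⟨ trans (sumSubsets-suc g) (+-comm _ _) ⟩
        sumSubsets m (g ∘ (outside ∷_)) + sumSubsets m (g ∘ (inside ∷_))
      ≈⟨ sym (sumSubsets-+ {m} _ _) ⟩
        sumSubsets m (λ X → g (outside ∷ X) + g (inside ∷ X))
      ≈⟨ sumSubsets-cong (λ X → +-congˡ (reflexive (cong (g ∘ (inside ∷_)) (≡.sym (∪-identityʳ X))))) ⟩
        sumSubsets m (λ X → g (outside ∷ X) + g (inside ∷ (X ∪ ⊥)))
      ≈⟨ trans (sym (+-identityˡ _)) (+-congʳ (sym (sumList-0 (allSubsets m)))) ⟩
        sumSubsets m (λ _ → 0#) + sumSubsets m (λ X → g (outside ∷ X) + g (inside ∷ (X ∪ ⊥)))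
      ≈⟨ sym (sumSubsets-suc {m} _) ⟩
        sumSubsets (suc m) (λ X → when (not (does (zero ∈? X))) (g X + g (X ∪ ⁅ zero ⁆)))
      ∎
    pairUp {suc m} (suc a) g =
      trans (sumSubsets-suc g)
            (trans (+-cong (pairUp a (g ∘ (inside ∷_))) (pairUp a (g ∘ (outside ∷_))))
                   (sym (sumSubsets-suc {m} _)))

    ∉-as-⊆ : ∀ X → when (not (does (a ∈? X))) (g X + g (X ∪ ⁅ a ⁆))
                 ≈ when (does (X ⊆? (⊤ ∖ a))) (g X + g (X ∪ ⁅ a ⁆))
    ∉-as-⊆ X with a ∈? X
    ... | yes a∈X = sym (when-no (X ⊆? (⊤ ∖ a)) (λ X⊆ → ⊆⊤∖⇒∉ X⊆ a∈X))
    ... | no  a∉X = sym (when-yes (X ⊆? (⊤ ∖ a)) (∉⇒⊆⊤∖ a∉X))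

  sumSubsetsOf-∪⁅⁆ : ∀ {n} {a : Fin n} {B : Subset n} → a ∉ B → (h : Subset n → Carrier) →
                     sumSubsetsOf (B ∪ ⁅ a ⁆) h ≈ sumSubsetsOf B (λ A → h (A ∪ ⁅ a ⁆)) + sumSubsetsOf B h
  sumSubsetsOf-∪⁅⁆ {n} {a} {B} a∉B h = begin
      sumSubsetsOf (B ∪ ⁅ a ⁆) h
    ≈⟨ sumSubsets-pairUp a _ ⟩
      sumSubsetsOf (⊤ ∖ a) (λ A → when (does (A ⊆? (B ∪ ⁅ a ⁆))) (h A)
                               + when (does ((A ∪ ⁅ a ⁆) ⊆? (B ∪ ⁅ a ⁆))) (h (A ∪ ⁅ a ⁆)))
    ≈⟨ sumSubsetsOf-cong (⊤ ∖ a) (λ A⊆ → trans (+-cong (below-∪⁅⁆ A⊆) (∪⁅⁆-below-∪⁅⁆ A⊆)) (+-comm _ _)) ⟩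
      sumSubsetsOf (⊤ ∖ a) (λ A → when (does (A ⊆? B)) (h (A ∪ ⁅ a ⁆)) + when (does (A ⊆? B)) (h A))
    ≈⟨ sumSubsetsOf-+ (⊤ ∖ a) _ _ ⟩
      sumSubsetsOf (⊤ ∖ a) (λ A → when (does (A ⊆? B)) (h (A ∪ ⁅ a ⁆)))
        + sumSubsetsOf (⊤ ∖ a) (λ A → when (does (A ⊆? B)) (h A))
    ≈⟨ +-cong (sumSubsetsOf-restrict B⊆⊤∖a _) (sumSubsetsOf-restrict B⊆⊤∖a h) ⟩
      sumSubsetsOf B (λ A → h (A ∪ ⁅ a ⁆)) + sumSubsetsOf B h
    ∎
    where
    B⊆⊤∖a : B ⊆ ⊤ ∖ a
    B⊆⊤∖a = ∉⇒⊆⊤∖ a∉B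

    below-∪⁅⁆ : ∀ {A} → A ⊆ ⊤ ∖ a →
                when (does (A ⊆? (B ∪ ⁅ a ⁆))) (h A) ≈ when (does (A ⊆? B)) (h A)
    below-∪⁅⁆ {A} A⊆ =
      when-⇔ (mk⇔ (⊆-∪⁅⁆⁻ (⊆⊤∖⇒∉ A⊆)) (λ A⊆B → ⊆-trans A⊆B (p⊆p∪q ⁅ a ⁆))) (A ⊆? (B ∪ ⁅ a ⁆)) (A ⊆? B)

    ∪⁅⁆-below-∪⁅⁆ : ∀ {A} → A ⊆ ⊤ ∖ a →
                    when (does ((A ∪ ⁅ a ⁆) ⊆? (B ∪ ⁅ a ⁆))) (h (A ∪ ⁅ a ⁆)) ≈ when (does (A ⊆? B)) (h (A ∪ ⁅ a ⁆))
    ∪⁅⁆-below-∪⁅⁆ {A} A⊆ =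
      when-⇔ (mk⇔ (∪⁅⁆-cancelˡ-⊆ (⊆⊤∖⇒∉ A⊆)) ∪⁅⁆-monoˡ-⊆) ((A ∪ ⁅ a ⁆) ⊆? (B ∪ ⁅ a ⁆)) (A ⊆? B)

module Chains {c ℓ : Level} (R : CommutativeRing c ℓ) where
  open CommutativeRing R hiding (zero; -_; _-_)
  open Sums semiring
  open SetoidReasoning setoid

  module _ {n : ℕ} where

    sumChains-nested : (E : Subset n) (f : Subset n → Subset n → Carrier) →
                       sumChains R E f ≈ sumSubsetsOf E (λ B → sumSubsetsOf B (λ A → f A B))
    sumChains-nested E f = begin
        sumChains R E f
      ≈⟨ sumList-concatMap _ pairsBelow (filter (_⊆? E) (allSubsets n)) ⟩
        sumList (sumList (λ p → f (proj₁ p) (proj₂ p)) ∘ pairsBelow) (filter (_⊆? E) (allSubsets n))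
      ≈⟨ sumList-filter (_⊆? E) _ (allSubsets n) ⟩
        sumSubsetsOf E (sumList (λ p → f (proj₁ p) (proj₂ p)) ∘ pairsBelow)
      ≈⟨ sumSubsetsOf-cong E (λ {B} _ → trans (sumList-map _ (_, B) (filter (_⊆? B) (allSubsets n)))
                                               (sumList-filter (_⊆? B) _ (allSubsets n))) ⟩
        sumSubsetsOf E (λ B → sumSubsetsOf B (λ A → f A B))
      ∎
      where
      pairsBelow : Subset n → List (Subset n × Subset n)
      pairsBelow B = map (_, B) (filter (_⊆? B) (allSubsets n))

    sumChains-cong : (E : Subset n) {f g : Subset n → Subset n → Carrier} →
                     (∀ {A B} → A ⊆ B → B ⊆ E → f A B ≈ g A B) → sumChains R E f ≈ sumChains R E g
    sumChains-cong E {f} {g} f≈g = begin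
        sumChains R E f
      ≈⟨ sumChains-nested E f ⟩
        sumSubsetsOf E (λ B → sumSubsetsOf B (λ A → f A B))
      ≈⟨ sumSubsetsOf-cong E (λ B⊆E → sumSubsetsOf-cong _ (λ A⊆B → f≈g A⊆B B⊆E)) ⟩
        sumSubsetsOf E (λ B → sumSubsetsOf B (λ A → g A B))
      ≈⟨ sumChains-nested E g ⟨
        sumChains R E g
      ∎

    sumChains-*ˡ : (E : Subset n) (k : Carrier) (f : Subset n → Subset n → Carrier) →
                   sumChains R E (λ A B → k * f A B) ≈ k * sumChains R E f
    sumChains-*ˡ E k f = sumList-*ˡ k (λ p → f (proj₁ p) (proj₂ p)) (chains E)

    sumChains-splitAt : (a : Fin n) (f : Subset n → Subset n → Carrier) →
                        sumChains R ⊤ f ≈ sumChains R (⊤ ∖ a) f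
                                        + sumChains R (⊤ ∖ a) (λ A B → f (A ∪ ⁅ a ⁆) (B ∪ ⁅ a ⁆))
                                        + sumChains R (⊤ ∖ a) (λ A B → f A (B ∪ ⁅ a ⁆))
    sumChains-splitAt a f = begin
        sumChains R ⊤ f
      ≈⟨ trans (sumChains-nested ⊤ f) (sumSubsetsOf-⊤ below) ⟩
        sumSubsets n below
      ≈⟨ sumSubsets-pairUp a below ⟩
        sumSubsetsOf (⊤ ∖ a) (λ B → below B + below (B ∪ ⁅ a ⁆))
      ≈⟨ sumSubsetsOf-cong (⊤ ∖ a) (λ B⊆ → +-congˡ (sumSubsetsOf-∪⁅⁆ (⊆⊤∖⇒∉ B⊆) _)) ⟩
        sumSubsetsOf (⊤ ∖ a) (λ B → below B + (belowContracted B + belowExtended B))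
      ≈⟨ trans (sumSubsetsOf-+ (⊤ ∖ a) _ _) (+-congˡ (sumSubsetsOf-+ (⊤ ∖ a) _ _)) ⟩
        sumSubsetsOf (⊤ ∖ a) below
          + (sumSubsetsOf (⊤ ∖ a) belowContracted + sumSubsetsOf (⊤ ∖ a) belowExtended)
      ≈⟨ sym (+-assoc _ _ _) ⟩
        sumSubsetsOf (⊤ ∖ a) below + sumSubsetsOf (⊤ ∖ a) belowContracted + sumSubsetsOf (⊤ ∖ a) belowExtended
      ≈⟨ +-cong (+-cong (sumChains-nested (⊤ ∖ a) _) (sumChains-nested (⊤ ∖ a) _))
                (sumChains-nested (⊤ ∖ a) _) ⟨
        sumChains R (⊤ ∖ a) f
          + sumChains R (⊤ ∖ a) (λ A B → f (A ∪ ⁅ a ⁆) (B ∪ ⁅ a ⁆))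
          + sumChains R (⊤ ∖ a) (λ A B → f A (B ∪ ⁅ a ⁆))
      ∎
      where
      below belowContracted belowExtended : Subset n → Carrier
      below           B = sumSubsetsOf B (λ A → f A B)
      belowContracted B = sumSubsetsOf B (λ A → f (A ∪ ⁅ a ⁆) (B ∪ ⁅ a ⁆))
      belowExtended   B = sumSubsetsOf B (λ A → f A (B ∪ ⁅ a ⁆))

module _ {n : ℕ} (M : Matroid n) where
  open Matroid M

  rk⁅x⁆≤1 : ∀ a → rk ⁅ a ⁆ ≤ 1
  rk⁅x⁆≤1 a = ≡.subst (rk ⁅ a ⁆ ≤_) (∣⁅x⁆∣≡1 a) (rk-bounded ⁅ a ⁆)

  ¬loop⇒rk⁅x⁆≡1 : ∀ {a} → ¬ IsLoop M a → rk ⁅ a ⁆ ≡ 1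
  ¬loop⇒rk⁅x⁆≡1 {a} ¬loop = ℕₚ.≤-antisym (rk⁅x⁆≤1 a) (ℕₚ.n≢0⇒n>0 ¬loop)

  rk⊤≤1+rk[⊤∖x] : ∀ a → rk ⊤ ≤ suc (rk (⊤ ∖ a))
  rk⊤≤1+rk[⊤∖x] a = begin
      rk ⊤                                           ≡⟨ cong rk (⊤∖x∪⁅x⁆≡⊤ a) ⟨
      rk ((⊤ ∖ a) ∪ ⁅ a ⁆)                           ≤⟨ ℕₚ.m≤m+n _ _ ⟩
      rk ((⊤ ∖ a) ∪ ⁅ a ⁆) ℕ.+ rk ((⊤ ∖ a) ∩ ⁅ a ⁆)  ≤⟨ rk-submod (⊤ ∖ a) ⁅ a ⁆ ⟩
      rk (⊤ ∖ a) ℕ.+ rk ⁅ a ⁆                        ≤⟨ ℕₚ.+-monoʳ-≤ (rk (⊤ ∖ a)) (rk⁅x⁆≤1 a) ⟩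
      rk (⊤ ∖ a) ℕ.+ 1                               ≡⟨ ℕₚ.+-comm (rk (⊤ ∖ a)) 1 ⟩
      suc (rk (⊤ ∖ a))                               ∎
    where open ℕₚ.≤-Reasoning

  ¬coloop⇒rk⊤≡rk[⊤∖x] : ∀ {a} → ¬ IsColoop M a → rk ⊤ ≡ rk (⊤ ∖ a)
  ¬coloop⇒rk⊤≡rk[⊤∖x] {a} ¬coloop with ℕₚ.m≤n⇒m<n∨m≡n (rk⊤≤1+rk[⊤∖x] a)
  ... | inj₁ rk⊤<1+rk[⊤∖a] = ℕₚ.≤-antisym (ℕₚ.m<1+n⇒m≤n rk⊤<1+rk[⊤∖a]) (rk-monotone (⊤ ∖ a) ⊤ ⊆⊤)
  ... | inj₂ coloop      = contradiction (≡.trans (ℕₚ.+-comm (rk (⊤ ∖ a)) 1) (≡.sym coloop)) ¬coloop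

  ¬loop⇒rk[X∪⁅x⁆]≡1+rkContr : ∀ {a} → ¬ IsLoop M a → ∀ X → rk (X ∪ ⁅ a ⁆) ≡ suc (rkContr M a X)
  ¬loop⇒rk[X∪⁅x⁆]≡1+rkContr {a} ¬loop X = begin
      rk (X ∪ ⁅ a ⁆)                            ≡⟨ ℕₚ.m+[n∸m]≡n (rk-monotone ⁅ a ⁆ (X ∪ ⁅ a ⁆) (q⊆p∪q X ⁅ a ⁆)) ⟨
      rk ⁅ a ⁆ ℕ.+ rkContr M a X                ≡⟨ cong (ℕ._+ rkContr M a X) (¬loop⇒rk⁅x⁆≡1 ¬loop) ⟩
      suc (rkContr M a X)                       ∎
    where open ≡.≡-Reasoning

  ¬loop⇒rk⊤≡1+rkOfContr : ∀ {a} → ¬ IsLoop M a → rk ⊤ ≡ suc (rkOfContr M a)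
  ¬loop⇒rk⊤≡1+rkOfContr {a} ¬loop =
    ≡.trans (cong rk (≡.sym (⊤∖x∪⁅x⁆≡⊤ a))) (¬loop⇒rk[X∪⁅x⁆]≡1+rkContr ¬loop (⊤ ∖ a))

module Summands {c ℓ : Level} (R : CommutativeRing c ℓ) {n : ℕ} (M : Matroid n) (a : Fin n)
                (x y z : CommutativeRing.Carrier R) where
  open CommutativeRing R hiding (zero; -_; _-_)
  open CommutativeSemigroupProperties *-commutativeSemigroup using (x∙yz≈y∙xz)
  open Matroid M

  monomial : ℕ → ℕ → ℕ → Carrier
  monomial i j k = pow R x i * pow R y j * pow R z k

  monomial-≡ : ∀ {i i′ j j′ k k′} → i ≡ i′ → j ≡ j′ → k ≡ k′ → monomial i j k ≡ monomial i′ j′ k′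
  monomial-≡ ≡.refl ≡.refl ≡.refl = ≡.refl

  monomial-suc : ∀ i j k → monomial i j (suc k) ≈ z * monomial i j k
  monomial-suc i j k = sym (x∙yz≈y∙xz z (pow R x i * pow R y j) (pow R z k))

  term : Subset n → Subset n → Carrier
  term A B = monomial (∣ A ∣ ∸ rk A) (rk ⊤ ∸ rk B) (∣ B ∣ ∸ ∣ A ∣)

  term-deleted : ¬ IsColoop M a → ∀ A B →
                 term A B ≡ monomial (∣ A ∣ ∸ rk A) (rk (⊤ ∖ a) ∸ rk B) (∣ B ∣ ∸ ∣ A ∣)
  term-deleted ¬coloop A B =
    cong (λ r → monomial (∣ A ∣ ∸ rk A) (r ∸ rk B) (∣ B ∣ ∸ ∣ A ∣)) (¬coloop⇒rk⊤≡rk[⊤∖x] M ¬coloop)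

  term-contracted : ¬ IsLoop M a → ∀ {A B} → a ∉ A → a ∉ B →
                    term (A ∪ ⁅ a ⁆) (B ∪ ⁅ a ⁆)
                      ≡ monomial (∣ A ∣ ∸ rkContr M a A) (rkOfContr M a ∸ rkContr M a B) (∣ B ∣ ∸ ∣ A ∣)
  term-contracted ¬loop {A} {B} a∉A a∉B = monomial-≡
    (cong₂ _∸_ (∣p∪⁅x⁆∣≡1+∣p∣ A a∉A) (¬loop⇒rk[X∪⁅x⁆]≡1+rkContr M ¬loop A))
    (cong₂ _∸_ (¬loop⇒rk⊤≡1+rkOfContr M ¬loop) (¬loop⇒rk[X∪⁅x⁆]≡1+rkContr M ¬loop B))
    (cong₂ _∸_ (∣p∪⁅x⁆∣≡1+∣p∣ B a∉B) (∣p∪⁅x⁆∣≡1+∣p∣ A a∉A))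

  term-extended : ¬ IsLoop M a → ∀ {A B} → A ⊆ B → a ∉ B →
                  term A (B ∪ ⁅ a ⁆)
                    ≈ z * monomial (∣ A ∣ ∸ rk A) (rkOfContr M a ∸ rkContr M a B) (∣ B ∣ ∸ ∣ A ∣)
  term-extended ¬loop {A} {B} A⊆B a∉B = trans
    (reflexive (cong₂ (monomial (∣ A ∣ ∸ rk A))
      (cong₂ _∸_ (¬loop⇒rk⊤≡1+rkOfContr M ¬loop) (¬loop⇒rk[X∪⁅x⁆]≡1+rkContr M ¬loop B))
      (≡.trans (cong (_∸ ∣ A ∣) (∣p∪⁅x⁆∣≡1+∣p∣ B a∉B)) (ℕₚ.+-∸-assoc 1 (p⊆q⇒∣p∣≤∣q∣ A⊆B)))))
    (monomial-suc (∣ A ∣ ∸ rk A) (rkOfContr M a ∸ rkContr M a B) (∣ B ∣ ∸ ∣ A ∣))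

proposition5p27 : {c ℓ : Level} (R : CommutativeRing c ℓ) {n : ℕ} (M : Matroid n) (a : Fin n) →
    ¬ IsLoop M a → ¬ IsColoop M a →
    let open CommutativeRing R hiding (-_) in
    (x y z : Carrier) →
    S R (asRanked M) x y z
      ≈ S R (deletion M a) x y z + S R (contraction M a) x y z
        + z * sumChains R (⊤ ∖ a) (λ A B →
                pow R x (∣ A ∣ ∸ Matroid.rk M A)
                * pow R y (rkOfContr M a ∸ rkContr M a B)
                * pow R z (∣ B ∣ ∸ ∣ A ∣))
proposition5p27 R M a ¬loop ¬coloop x y z =
  trans (sumChains-splitAt a term)
        (+-cong (+-cong (sumChains-cong (⊤ ∖ a) λ {A} {B} _ _ → reflexive (term-deleted ¬coloop A B))
                        (sumChains-cong (⊤ ∖ a) λ A⊆B B⊆ →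
                           reflexive (term-contracted ¬loop (⊆⊤∖⇒∉ (⊆-trans A⊆B B⊆)) (⊆⊤∖⇒∉ B⊆))))
                (trans (sumChains-cong (⊤ ∖ a) λ A⊆B B⊆ → term-extended ¬loop A⊆B (⊆⊤∖⇒∉ B⊆))
                       (sumChains-*ˡ (⊤ ∖ a) z _)))
  where
  open CommutativeRing R hiding (-_)
  open Chains R
  open Summands R M a x y z
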